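{- For any graph $G$ and any positive integers $n$ and $t$, $\pi_t^*(G\Box K_n)\le \pi^*_{2t}(G)$. Furthermore, equality holds when $2n\ge \pi^*_{2t}(G)+1$.
   Context: Graphs are finite simple graphs. A distribution on a graph $G=(V,E)$ is a function $D:V\to\mathbb{N}$, with size $|D|=\sum_v D(v)$. A pebbling move removes two pebbles from a vertex having at least two pebbles and places one pebble on a neighbor. A distribution $D$ is $t$-solvable if for every vertex $v$, some sequence of pebbling moves starting from $D$ results in a distribution with at least $t$ pebbles on $v$. The optimal $t$-pebbling number $\pi_t^*(G)$ is the minimum size of a $t$-solvable distribution on $G$. $K_n$ is the complete graph on $n$ vertices and $\Box$ is the Cartesian product of graphs. -}

module Defs where

open import Level using (0ℓ)
open import Data.Nat using (ℕ; _+_; _*_; _≤_; _≥_)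
open import Data.Fin using (Fin)
open import Data.List using (List; map; cartesianProduct; allFin)
open import Data.Nat.ListAction using (sum)
open import Data.List.Membership.Propositional using (_∈_)
open import Data.List.Membership.Propositional.Properties using (∈-cartesianProduct⁺; ∈-allFin)
open import Data.List.Relation.Unary.Unique.Propositional using (Unique)
open import Data.List.Relation.Unary.Unique.Propositional.Properties using (cartesianProduct⁺; allFin⁺)
open import Data.Product using (Σ; ∃; _×_; _,_; proj₁; proj₂)
open import Data.Sum using (_⊎_; inj₁; inj₂)
open import Data.Empty using (⊥)
open import Relation.Nullary using (¬_)
open import Relation.Binary.PropositionalEquality using (_≡_; _≢_; refl; sym)
open import Relation.Binary.Construct.Closure.ReflexiveTransitive using (Star)

record Graph : Set₁ where
  field
    V          : Set
    vertices   : List V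
    unique     : Unique vertices
    complete   : ∀ v → v ∈ vertices
    Adj        : V → V → Set
    Adj-sym    : ∀ {u v} → Adj u v → Adj v u
    Adj-irrefl : ∀ {v} → ¬ Adj v v
open Graph public

K : ℕ → Graph
K n = record
  { V = Fin n
  ; vertices = allFin n
  ; unique = allFin⁺ n
  ; complete = ∈-allFin
  ; Adj = λ i j → i ≢ j
  ; Adj-sym = λ i≢j j≡i → i≢j (sym j≡i)
  ; Adj-irrefl = λ i≢i → i≢i refl
  }

_□_ : Graph → Graph → Graph
G □ H = record
  { V = V G × V H
  ; vertices = cartesianProduct (vertices G) (vertices H)
  ; unique = cartesianProduct⁺ (unique G) (unique H)
  ; complete = λ { (u , x) → ∈-cartesianProduct⁺ (complete G u) (complete H x) }
  ; Adj = λ { (u , x) (v , y) → (Adj G u v × x ≡ y) ⊎ (u ≡ v × Adj H x y) }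
  ; Adj-sym = λ { (inj₁ (a , e)) → inj₁ (Adj-sym G a , sym e)
                ; (inj₂ (e , a)) → inj₂ (sym e , Adj-sym H a) }
  ; Adj-irrefl = λ { (inj₁ (a , _)) → Adj-irrefl G a
                   ; (inj₂ (_ , a)) → Adj-irrefl H a }
  }

Distribution : Graph → Set
Distribution G = V G → ℕ

size : (G : Graph) → Distribution G → ℕ
size G D = sum (map D (vertices G))

data Move (G : Graph) (D D' : Distribution G) : Set where
  move : (u v : V G) → Adj G u v → 2 ≤ D u →
         D' u + 2 ≡ D u → D' v ≡ D v + 1 →
         (∀ w → w ≢ u → w ≢ v → D' w ≡ D w) →
         Move G D D'

Reachable : (G : Graph) → Distribution G → Distribution G → Set
Reachable G = Star (Move G)

Solvable : (G : Graph) → ℕ → Distribution G → Set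
Solvable G t D = ∀ v → ∃ λ D' → Reachable G D D' × t ≤ D' v

IsOptPebbling : (G : Graph) → ℕ → ℕ → Set
IsOptPebbling G t k =
  (∃ λ D → Solvable G t D × size G D ≡ k) ×
  (∀ D → Solvable G t D → k ≤ size G D)

-- Upper bound: an optimal 2t-solvable distribution of G, placed on the layer G × {0}, is
-- t-solvable on G □ K n: a vertex (v , 0) is reached as in G, and (v , i) by first gathering
-- 2t pebbles on (v , 0) and then making t moves along the edge from (v , 0) to (v , i).
-- Lower bound: if S is t-solvable on G □ K n and 2 + |S| ≤ 2n, then some layer j is empty or
-- two layers j ≢ k hold one pebble each. Collapsing S onto G with weight 2 on layer j, weight 0
-- on layer k and 1 elsewhere gives a distribution R of size |S|. Every pebbling sequence in
-- G □ K n is shadowed by one in G that keeps the projection with weights α (2 on j and k,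
-- 1 elsewhere) pointwise below the current distribution on G, up to a credit of 2 where the
-- lone pebble of layer k sits: a move inside a layer of weight α is replayed by α moves of G,
-- and a move between layers does not increase the projection. So t pebbles on (v , j) give
-- 2t pebbles on v, R is 2t-solvable, and π*_{2t}(G) ≤ |S|.

module Submission where

open import Defs
open import Data.Nat using (ℕ; zero; suc; _+_; _*_; _∸_; _≤_; _≥_; _<_; z≤n; s≤s)
open import Data.Nat.Properties
open import Data.Nat.Tactic.RingSolver using (solve-∀)
open import Algebra.Properties.CommutativeSemigroup +-commutativeSemigroup using (interchange; xy∙z≈xz∙y)
open import Data.Nat.ListAction using (sum)
open import Data.Nat.ListAction.Properties using (sum-++)
open import Data.Fin using () renaming (zero to fzero)
open import Data.List using (List; []; _∷_; _++_; map; length; cartesianProduct)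
open import Data.List.Properties using (map-++; map-∘; map-cong; length-tabulate)
open import Data.List.Membership.Propositional using (_∈_)
open import Data.List.Relation.Unary.Any using (here; there)
open import Data.List.Relation.Unary.All using (lookup)
open import Data.List.Relation.Unary.AllPairs using (_∷_)
open import Data.List.Relation.Unary.Unique.Propositional using (Unique)
open import Data.Maybe using (Maybe; just; nothing)
open import Data.Product using (∃; ∃₂; _×_; _,_; proj₁; proj₂)
open import Data.Sum using (_⊎_; inj₁; inj₂)
open import Data.Unit using (⊤; tt)
open import Data.Empty using (⊥; ⊥-elim)
open import Function using (_∘_; id)
open import Relation.Nullary using (Dec; yes; no; ¬_)
open import Relation.Binary.Definitions using (DecidableEquality)
open import Relation.Binary.PropositionalEquality
open import Relation.Binary.Construct.Closure.ReflexiveTransitive using (ε; _◅_; _◅◅_; gmap)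

∑ : {A : Set} → List A → (A → ℕ) → ℕ
∑ xs f = sum (map f xs)

module _ {A : Set} where

  ∑-cong : {f g : A → ℕ} → (∀ x → f x ≡ g x) → (xs : List A) → ∑ xs f ≡ ∑ xs g
  ∑-cong f≗g xs = cong sum (map-cong f≗g xs)

  ∑-mono-≤ : {f g : A → ℕ} → (∀ x → f x ≤ g x) → (xs : List A) → ∑ xs f ≤ ∑ xs g
  ∑-mono-≤ f≤g []       = z≤n
  ∑-mono-≤ f≤g (x ∷ xs) = +-mono-≤ (f≤g x) (∑-mono-≤ f≤g xs)

  ∑-zero : {f : A → ℕ} (xs : List A) → (∀ x → x ∈ xs → f x ≡ 0) → ∑ xs f ≡ 0
  ∑-zero []       _   = refl
  ∑-zero (x ∷ xs) f≡0 = cong₂ _+_ (f≡0 x (here refl)) (∑-zero xs (λ y y∈ → f≡0 y (there y∈)))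

  ∑≡0⇒zero : (f : A → ℕ) (xs : List A) → ∑ xs f ≡ 0 → ∀ x → x ∈ xs → f x ≡ 0
  ∑≡0⇒zero f (y ∷ xs) ∑≡0 x (here refl) = m+n≡0⇒m≡0 (f y) ∑≡0
  ∑≡0⇒zero f (y ∷ xs) ∑≡0 x (there x∈)  = ∑≡0⇒zero f xs (m+n≡0⇒n≡0 (f y) ∑≡0) x x∈

  ∑-+ : (f g : A → ℕ) (xs : List A) → ∑ xs (λ x → f x + g x) ≡ ∑ xs f + ∑ xs g
  ∑-+ f g []       = refl
  ∑-+ f g (x ∷ xs) = trans (cong (f x + g x +_) (∑-+ f g xs)) (interchange (f x) (g x) _ _)

  ∑-*ˡ : (c : ℕ) (f : A → ℕ) (xs : List A) → ∑ xs (λ x → c * f x) ≡ c * ∑ xs f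
  ∑-*ˡ c f []       = sym (*-zeroʳ c)
  ∑-*ˡ c f (x ∷ xs) = trans (cong (c * f x +_) (∑-*ˡ c f xs)) (sym (*-distribˡ-+ c (f x) _))

  ∃-at-most-one : (c : A → ℕ) (xs : List A) → ∑ xs c < 2 * length xs → ∃ λ x → x ∈ xs × c x ≤ 1
  ∃-at-most-one c (x ∷ xs) ∑<2n with c x in cx
  ... | zero          = x , here refl , ≤-trans (≤-reflexive cx) z≤n
  ... | suc zero      = x , here refl , ≤-reflexive cx
  ... | suc (suc c-x) =
    let (y , y∈ , cy≤1) = ∃-at-most-one c xs (+-cancelˡ-≤ 2 _ _
          (≤-trans (s≤s (s≤s (s≤s (m≤n+m _ c-x)))) (≤-trans ∑<2n (≤-reflexive (*-suc 2 (length xs))))))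
    in y , there y∈ , cy≤1

  empty-or-two-singletons : (c : A → ℕ) {xs : List A} → Unique xs → 2 + ∑ xs c ≤ 2 * length xs →
    (∃ λ x → x ∈ xs × c x ≡ 0) ⊎ (∃₂ λ x y → x ∈ xs × y ∈ xs × x ≢ y × c x ≡ 1 × c y ≡ 1)
  empty-or-two-singletons c {x ∷ xs} (x∉xs ∷ xs!) 2+∑≤2n
    with c x in cx | ≤-trans 2+∑≤2n (≤-reflexive (*-suc 2 (length xs)))
  ... | zero          | _      = inj₁ (x , here refl , cx)
  ... | suc zero      | 3+∑≤2n with ∃-at-most-one c xs (+-cancelˡ-≤ 2 _ _ 3+∑≤2n)
  ...   | y , y∈ , cy≤1 with c y in cy
  ...     | zero     = inj₁ (y , there y∈ , cy)
  ...     | suc zero = inj₂ (x , y , here refl , there y∈ , lookup x∉xs y∈ , cx , cy)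
  ...     | suc (suc _) with s≤s () ← cy≤1
  empty-or-two-singletons c {x ∷ xs} (x∉xs ∷ xs!) _ | suc (suc c-x) | 4+∑≤2n
    with empty-or-two-singletons c xs!
           (+-cancelˡ-≤ 2 _ _ (≤-trans (s≤s (s≤s (s≤s (s≤s (m≤n+m _ c-x))))) 4+∑≤2n))
  ... | inj₁ (y , y∈ , cy) = inj₁ (y , there y∈ , cy)
  ... | inj₂ (y , z , y∈ , z∈ , rest) = inj₂ (y , z , there y∈ , there z∈ , rest)

module _ {A B : Set} where

  ∑-swap : (xs : List A) (ys : List B) (f : A → B → ℕ) →
           ∑ xs (λ x → ∑ ys (f x)) ≡ ∑ ys (λ y → ∑ xs (λ x → f x y))
  ∑-swap []       ys f = sym (∑-zero ys (λ _ _ → refl))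
  ∑-swap (x ∷ xs) ys f =
    trans (cong (∑ ys (f x) +_) (∑-swap xs ys f)) (sym (∑-+ (f x) (λ y → ∑ xs (λ x → f x y)) ys))

  ∑-cartesianProduct : (xs : List A) (ys : List B) (f : A × B → ℕ) →
                       ∑ (cartesianProduct xs ys) f ≡ ∑ xs (λ x → ∑ ys (λ y → f (x , y)))
  ∑-cartesianProduct []       ys f = refl
  ∑-cartesianProduct (x ∷ xs) ys f = begin
    sum (map f (map (x ,_) ys ++ cartesianProduct xs ys))
      ≡⟨ cong sum (map-++ f (map (x ,_) ys) _) ⟩
    sum (map f (map (x ,_) ys) ++ map f (cartesianProduct xs ys))
      ≡⟨ sum-++ (map f (map (x ,_) ys)) _ ⟩
    sum (map f (map (x ,_) ys)) + ∑ (cartesianProduct xs ys) f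
      ≡⟨ cong₂ _+_ (cong sum (sym (map-∘ ys))) (∑-cartesianProduct xs ys f) ⟩
    ∑ ys (λ y → f (x , y)) + ∑ xs (λ x → ∑ ys (λ y → f (x , y))) ∎
    where open ≡-Reasoning

≡-dec-∈ : {A : Set} {xs : List A} {x y : A} → Unique xs → x ∈ xs → y ∈ xs → Dec (x ≡ y)
≡-dec-∈ (_ ∷ _)     (here refl) (here refl) = yes refl
≡-dec-∈ (x∉xs ∷ _)  (here refl) (there y∈)  = no (lookup x∉xs y∈)
≡-dec-∈ (y∉xs ∷ _)  (there x∈)  (here refl) = no (lookup y∉xs x∈ ∘ sym)
≡-dec-∈ (_ ∷ xs!)   (there x∈)  (there y∈)  = ≡-dec-∈ xs! x∈ y∈

vertex-≟ : (G : Graph) → DecidableEquality (V G)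
vertex-≟ G x y = ≡-dec-∈ (unique G) (complete G x) (complete G y)

δ : (G : Graph) → V G → V G → ℕ
δ G x y with vertex-≟ G x y
... | yes _ = 1
... | no  _ = 0

module _ (G : Graph) where

  δ-refl : (x : V G) → δ G x x ≡ 1
  δ-refl x with vertex-≟ G x x
  ... | yes _   = refl
  ... | no x≢x = ⊥-elim (x≢x refl)

  δ-≢ : {x y : V G} → x ≢ y → δ G x y ≡ 0
  δ-≢ {x} {y} x≢y with vertex-≟ G x y
  ... | yes x≡y = ⊥-elim (x≢y x≡y)
  ... | no  _   = refl

  δ≤1 : (x y : V G) → δ G x y ≤ 1
  δ≤1 x y with vertex-≟ G x y
  ... | yes _ = s≤s z≤n
  ... | no  _ = z≤n

  δ-disjoint : {x y : V G} → x ≢ y → ∀ z → δ G x z + δ G y z ≤ 1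
  δ-disjoint {x} {y} x≢y z with vertex-≟ G x z | vertex-≟ G y z
  ... | yes refl | yes refl = ⊥-elim (x≢y refl)
  ... | yes _    | no _     = ≤-refl
  ... | no _     | yes _    = ≤-refl
  ... | no _     | no _     = z≤n

  ∑-sift : (x : V G) (f : V G → ℕ) → ∑ (vertices G) (λ z → δ G x z * f z) ≡ f x
  ∑-sift x f = sift (unique G) (complete G x)
    where
    sift : {xs : List (V G)} → Unique xs → x ∈ xs → ∑ xs (λ z → δ G x z * f z) ≡ f x
    sift {x ∷ xs} (x∉xs ∷ _) (here refl) = begin
      δ G x x * f x + ∑ xs (λ z → δ G x z * f z)
        ≡⟨ cong₂ _+_ (cong (_* f x) (δ-refl x))
                   (∑-zero xs (λ z z∈ → cong (_* f z) (δ-≢ (lookup x∉xs z∈)))) ⟩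
      1 * f x + 0
        ≡⟨ trans (+-identityʳ _) (*-identityˡ (f x)) ⟩
      f x ∎
      where open ≡-Reasoning
    sift {y ∷ xs} (y∉xs ∷ xs!) (there x∈) =
      cong₂ _+_ (cong (_* f y) (δ-≢ (lookup y∉xs x∈ ∘ sym))) (sift xs! x∈)

  ∑-≥-point : (x : V G) (f : V G → ℕ) → f x ≤ ∑ (vertices G) f
  ∑-≥-point x f = begin
    f x                                  ≡⟨ sym (∑-sift x f) ⟩
    ∑ (vertices G) (λ z → δ G x z * f z) ≤⟨ ∑-mono-≤ at-most-once (vertices G) ⟩
    ∑ (vertices G) f                     ∎
    where
    open ≤-Reasoning
    at-most-once : ∀ z → δ G x z * f z ≤ f z
    at-most-once z = ≤-trans (*-monoˡ-≤ (f z) (δ≤1 x z)) (≤-reflexive (*-identityˡ (f z)))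

  ∑-≥-pair : {x y : V G} → x ≢ y → (f : V G → ℕ) → f x + f y ≤ ∑ (vertices G) f
  ∑-≥-pair {x} {y} x≢y f = begin
    f x + f y
      ≡⟨ sym (cong₂ _+_ (∑-sift x f) (∑-sift y f)) ⟩
    ∑ (vertices G) (λ z → δ G x z * f z) + ∑ (vertices G) (λ z → δ G y z * f z)
      ≡⟨ sym (∑-+ _ _ (vertices G)) ⟩
    ∑ (vertices G) (λ z → δ G x z * f z + δ G y z * f z)
      ≤⟨ ∑-mono-≤ at-most-once (vertices G) ⟩
    ∑ (vertices G) f ∎
    where
    open ≤-Reasoning
    at-most-once : ∀ z → δ G x z * f z + δ G y z * f z ≤ f z
    at-most-once z = ≤-trans (≤-reflexive (sym (*-distribʳ-+ (f z) (δ G x z) _)))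
                       (≤-trans (*-monoˡ-≤ (f z) (δ-disjoint x≢y z)) (≤-reflexive (*-identityˡ (f z))))

  ∑≡1⇒δ : (f : V G → ℕ) → ∑ (vertices G) f ≡ 1 → ∃ λ x → ∀ z → f z ≡ δ G x z
  ∑≡1⇒δ f ∑≡1 = let (x , _ , f≗δ) = lone (vertices G) ∑≡1 in x , λ z → f≗δ z (complete G z)
    where
    lone : (xs : List (V G)) → ∑ xs f ≡ 1 → ∃ λ x → x ∈ xs × (∀ z → z ∈ xs → f z ≡ δ G x z)
    lone (y ∷ xs) ∑≡1 with f y in fy
    ... | suc zero = y , here refl , f≗δ
      where
      f≗δ : ∀ z → z ∈ y ∷ xs → f z ≡ δ G y z
      f≗δ z z∈ with vertex-≟ G y z
      ... | yes refl = fy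
      ... | no  y≢z  with z∈
      ...   | here z≡y   = ⊥-elim (y≢z (sym z≡y))
      ...   | there z∈xs = ∑≡0⇒zero f xs (suc-injective ∑≡1) z z∈xs
    ... | suc (suc _) = ⊥-elim (1+n≢0 (suc-injective ∑≡1))
    ... | zero with lone xs ∑≡1
    ...   | x , x∈ , f≗δ = x , there x∈ , λ { z (here refl) → at-y ; z (there z∈) → f≗δ z z∈ }
      where
      at-y : f y ≡ δ G x y
      at-y with vertex-≟ G x y
      ... | yes refl = ⊥-elim (1+n≢0 (trans (sym (trans (f≗δ x x∈) (δ-refl x))) fy))
      ... | no  _    = fy

δ-pair : (G H : Graph) (u z : V G) (a m : V H) → δ (G □ H) (u , a) (z , m) ≡ δ G u z * δ H a m
δ-pair G H u z a m with vertex-≟ G u z | vertex-≟ H a m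
... | yes refl | yes refl = δ-refl (G □ H) (u , a)
... | no  u≢z  | _        = δ-≢ (G □ H) (u≢z ∘ cong proj₁)
... | yes _    | no  a≢m  = δ-≢ (G □ H) (a≢m ∘ cong proj₂)

-- c pebbles shipped from u to w at the cost of 2c, stated additively to avoid truncated
-- subtraction.
record Transfer (G : Graph) (c : ℕ) (u w : V G) (D D′ : Distribution G) : Set where
  constructor transferred
  field
    balance : ∀ z → D′ z + 2 * c * δ G u z ≡ D z + c * δ G w z
open Transfer public

module _ (G : Graph) where

  adj⇒≢ : {u w : V G} → Adj G u w → u ≢ w
  adj⇒≢ adj refl = Adj-irrefl G adj

  transfer-≥ : ∀ {c u w D D′ z} → z ≢ u → Transfer G c u w D D′ → D z ≤ D′ z
  transfer-≥ {c} {u} {w} {D} {D′} {z} z≢u T = +-cancelʳ-≤ 0 (D z) (D′ z) (begin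
    D z + 0                ≤⟨ +-monoʳ-≤ (D z) z≤n ⟩
    D z + c * δ G w z      ≡⟨ sym (balance T z) ⟩
    D′ z + 2 * c * δ G u z ≡⟨ cong (λ d → D′ z + 2 * c * d) (δ-≢ G (z≢u ∘ sym)) ⟩
    D′ z + 2 * c * 0       ≡⟨ cong (D′ z +_) (*-zeroʳ (2 * c)) ⟩
    D′ z + 0               ∎)
    where open ≤-Reasoning

  transfer-source : ∀ {c u w D D′} → u ≢ w → Transfer G c u w D D′ → D′ u + 2 * c ≡ D u
  transfer-source {c} {u} {w} {D} {D′} u≢w T = begin
    D′ u + 2 * c           ≡⟨ cong (D′ u +_) (sym (*-identityʳ (2 * c))) ⟩
    D′ u + 2 * c * 1       ≡⟨ cong (λ d → D′ u + 2 * c * d) (sym (δ-refl G u)) ⟩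
    D′ u + 2 * c * δ G u u ≡⟨ balance T u ⟩
    D u + c * δ G w u      ≡⟨ cong (λ d → D u + c * d) (δ-≢ G (u≢w ∘ sym)) ⟩
    D u + c * 0            ≡⟨ trans (cong (D u +_) (*-zeroʳ c)) (+-identityʳ (D u)) ⟩
    D u                    ∎
    where open ≡-Reasoning

  transfer-target : ∀ {c u w D D′} → u ≢ w → Transfer G c u w D D′ → D′ w ≡ D w + c
  transfer-target {c} {u} {w} {D} {D′} u≢w T = begin
    D′ w                   ≡⟨ sym (+-identityʳ (D′ w)) ⟩
    D′ w + 0               ≡⟨ cong (D′ w +_) (sym (*-zeroʳ (2 * c))) ⟩
    D′ w + 2 * c * 0       ≡⟨ cong (λ d → D′ w + 2 * c * d) (sym (δ-≢ G u≢w)) ⟩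
    D′ w + 2 * c * δ G u w ≡⟨ balance T w ⟩
    D w + c * δ G w w      ≡⟨ cong (λ d → D w + c * d) (δ-refl G w) ⟩
    D w + c * 1            ≡⟨ cong (D w +_) (*-identityʳ c) ⟩
    D w + c                ∎
    where open ≡-Reasoning

  transfer-delivers : ∀ {c u w D D′} → u ≢ w → Transfer G c u w D D′ → c ≤ D′ w
  transfer-delivers {c} {w = w} {D} u≢w T = subst (c ≤_) (sym (transfer-target u≢w T)) (m≤n+m c (D w))

  transfer-trans : ∀ {c d u w D₁ D₂ D₃} → Transfer G c u w D₁ D₂ → Transfer G d u w D₂ D₃ →
                   Transfer G (c + d) u w D₁ D₃
  transfer-trans {c} {d} {u} {w} {D₁} {D₂} {D₃} T₁₂ T₂₃ = transferred λ z → begin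
    D₃ z + 2 * (c + d) * δ G u z            ≡⟨ split (D₃ z) c d (δ G u z) ⟩
    D₃ z + 2 * d * δ G u z + 2 * c * δ G u z ≡⟨ cong (_+ 2 * c * δ G u z) (balance T₂₃ z) ⟩
    D₂ z + d * δ G w z + 2 * c * δ G u z     ≡⟨ xy∙z≈xz∙y (D₂ z) _ _ ⟩
    D₂ z + 2 * c * δ G u z + d * δ G w z     ≡⟨ cong (_+ d * δ G w z) (balance T₁₂ z) ⟩
    D₁ z + c * δ G w z + d * δ G w z         ≡⟨ merge (D₁ z) c d (δ G w z) ⟩
    D₁ z + (c + d) * δ G w z                 ∎
    where
    open ≡-Reasoning
    split : ∀ x c d y → x + 2 * (c + d) * y ≡ x + 2 * d * y + 2 * c * y
    split = solve-∀
    merge : ∀ x c d y → x + c * y + d * y ≡ x + (c + d) * y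
    merge = solve-∀

  move⇒transfer : ∀ {D D′} → Move G D D′ → ∃₂ λ u w → Adj G u w × 2 ≤ D u × Transfer G 1 u w D D′
  move⇒transfer {D} {D′} (move u w adj 2≤Du src tgt rest) = u , w , adj , 2≤Du , transferred T
    where
    T : ∀ z → D′ z + 2 * 1 * δ G u z ≡ D z + 1 * δ G w z
    T z with vertex-≟ G u z | vertex-≟ G w z
    ... | yes refl | yes refl = ⊥-elim (adj⇒≢ adj refl)
    ... | yes refl | no _     = trans src (sym (+-identityʳ (D u)))
    ... | no _     | yes refl = trans (+-identityʳ (D′ w)) tgt
    ... | no u≢z   | no w≢z   = cong (_+ 0) (rest z (u≢z ∘ sym) (w≢z ∘ sym))

  transfer⇒move : ∀ {u w D D′} → Adj G u w → 2 ≤ D u → Transfer G 1 u w D D′ → Move G D D′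
  transfer⇒move {u} {w} {D} {D′} adj 2≤Du T =
    move u w adj 2≤Du (transfer-source u≢w T) (transfer-target u≢w T) unchanged
    where
    u≢w : u ≢ w
    u≢w = adj⇒≢ adj
    unchanged : ∀ z → z ≢ u → z ≢ w → D′ z ≡ D z
    unchanged z z≢u z≢w = +-cancelʳ-≡ 0 (D′ z) (D z) (begin
      D′ z + 0           ≡⟨ cong (λ d → D′ z + 2 * d) (sym (δ-≢ G (z≢u ∘ sym))) ⟩
      D′ z + 2 * δ G u z ≡⟨ balance T z ⟩
      D z + 1 * δ G w z  ≡⟨ cong (λ d → D z + 1 * d) (δ-≢ G (z≢w ∘ sym)) ⟩
      D z + 0            ∎)
      where open ≡-Reasoning

  transfer : ∀ {u w D} → Adj G u w → (c : ℕ) → 2 * c ≤ D u →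
             ∃ λ D′ → Reachable G D D′ × Transfer G c u w D D′
  transfer {D = D} adj zero    _        = D , ε , transferred λ _ → refl
  transfer {u} {w} {D} adj (suc c) 2c+2≤Du =
    let (D₂ , moves , T₁₂) = transfer adj c 2c≤D₁u
    in D₂ , transfer⇒move adj 2≤Du T₀₁ ◅ moves , transfer-trans T₀₁ T₁₂
    where
    2≤Du : 2 ≤ D u
    2≤Du = ≤-trans (≤-trans (m≤m+n 2 (2 * c)) (≤-reflexive (sym (*-suc 2 c)))) 2c+2≤Du

    D₁ : Distribution G
    D₁ z = D z ∸ 2 * δ G u z + δ G w z

    2δ≤D : ∀ z → 2 * δ G u z ≤ D z
    2δ≤D z with vertex-≟ G u z
    ... | yes refl = 2≤Du
    ... | no  _    = z≤n

    T₀₁ : Transfer G 1 u w D D₁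
    T₀₁ = transferred λ z → begin
      D z ∸ 2 * δ G u z + δ G w z + 2 * δ G u z ≡⟨ xy∙z≈xz∙y (D z ∸ 2 * δ G u z) _ _ ⟩
      D z ∸ 2 * δ G u z + 2 * δ G u z + δ G w z ≡⟨ cong (_+ δ G w z) (m∸n+n≡m (2δ≤D z)) ⟩
      D z + δ G w z                             ≡⟨ cong (D z +_) (sym (+-identityʳ (δ G w z))) ⟩
      D z + 1 * δ G w z                         ∎
      where open ≡-Reasoning

    2c≤D₁u : 2 * c ≤ D₁ u
    2c≤D₁u = +-cancelʳ-≤ 2 (2 * c) (D₁ u) (begin
      2 * c + 2   ≡⟨ +-comm (2 * c) 2 ⟩
      2 + 2 * c   ≡⟨ sym (*-suc 2 c) ⟩
      2 * suc c   ≤⟨ 2c+2≤Du ⟩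
      D u         ≡⟨ sym (transfer-source (adj⇒≢ adj) T₀₁) ⟩
      D₁ u + 2    ∎)
      where open ≤-Reasoning

module _ (G H : Graph) where

  collapse : (V H → ℕ) → Distribution (G □ H) → Distribution G
  collapse α S u = ∑ (vertices H) (λ m → α m * S (u , m))

  layer : Distribution (G □ H) → V H → ℕ
  layer S m = ∑ (vertices G) (λ u → S (u , m))

  size-□ : (S : Distribution (G □ H)) →
           size (G □ H) S ≡ ∑ (vertices G) (λ u → ∑ (vertices H) (λ m → S (u , m)))
  size-□ = ∑-cartesianProduct (vertices G) (vertices H)

  size-□-layers : (S : Distribution (G □ H)) → size (G □ H) S ≡ ∑ (vertices H) (layer S)
  size-□-layers S = trans (size-□ S) (∑-swap (vertices G) (vertices H) (λ u m → S (u , m)))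

  size-collapse : (α : V H → ℕ) (S : Distribution (G □ H)) →
                  size G (collapse α S) ≡ ∑ (vertices H) (λ m → α m * layer S m)
  size-collapse α S = trans (∑-swap (vertices G) (vertices H) (λ u m → α m * S (u , m)))
                            (∑-cong (λ m → ∑-*ˡ (α m) (λ u → S (u , m)) (vertices G)) (vertices H))

  collapse-≥-point : (α : V H → ℕ) (S : Distribution (G □ H)) (u : V G) (a : V H) →
                     α a * S (u , a) ≤ collapse α S u
  collapse-≥-point α S u a = ∑-≥-point H a (λ m → α m * S (u , m))

  collapse-≥-pair : (α : V H → ℕ) (S : Distribution (G □ H)) (u : V G) {a b : V H} → a ≢ b →
                    α a * S (u , a) + α b * S (u , b) ≤ collapse α S u
  collapse-≥-pair α S u a≢b = ∑-≥-pair H a≢b (λ m → α m * S (u , m))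

  collapse-split : (α β : V H → ℕ) (c : ℕ) (k : V H) → (∀ m → α m ≡ β m + c * δ H k m) →
                   ∀ S u → collapse α S u ≡ collapse β S u + c * S (u , k)
  collapse-split α β c k α≗β+cδ S u = begin
    ∑ (vertices H) (λ m → α m * S (u , m))
      ≡⟨ ∑-cong (λ m → trans (cong (_* S (u , m)) (α≗β+cδ m)) (distrib (β m) c (δ H k m) (S (u , m))))
                (vertices H) ⟩
    ∑ (vertices H) (λ m → β m * S (u , m) + c * (δ H k m * S (u , m)))
      ≡⟨ ∑-+ _ _ (vertices H) ⟩
    collapse β S u + ∑ (vertices H) (λ m → c * (δ H k m * S (u , m)))
      ≡⟨ cong (collapse β S u +_) (trans (∑-*ˡ c _ (vertices H)) (cong (c *_) (∑-sift H k _))) ⟩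
    collapse β S u + c * S (u , k) ∎
    where
    open ≡-Reasoning
    distrib : ∀ b c d s → (b + c * d) * s ≡ b * s + c * (d * s)
    distrib = solve-∀

  collapse-δ : (α : V H → ℕ) (u z : V G) (a : V H) →
               ∑ (vertices H) (λ m → α m * δ (G □ H) (u , a) (z , m)) ≡ α a * δ G u z
  collapse-δ α u z a = begin
    ∑ (vertices H) (λ m → α m * δ (G □ H) (u , a) (z , m))
      ≡⟨ ∑-cong (λ m → trans (cong (α m *_) (δ-pair G H u z a m)) (reorder (α m) (δ G u z) (δ H a m)))
                (vertices H) ⟩
    ∑ (vertices H) (λ m → δ G u z * (δ H a m * α m))
      ≡⟨ ∑-*ˡ (δ G u z) _ (vertices H) ⟩
    δ G u z * ∑ (vertices H) (λ m → δ H a m * α m)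
      ≡⟨ cong (δ G u z *_) (∑-sift H a α) ⟩
    δ G u z * α a
      ≡⟨ *-comm (δ G u z) (α a) ⟩
    α a * δ G u z ∎
    where
    open ≡-Reasoning
    reorder : ∀ x y z → x * (y * z) ≡ y * (z * x)
    reorder = solve-∀

  collapse-transfer : (α : V H → ℕ) {S S′ : Distribution (G □ H)} {u w : V G} {a b : V H} →
                      Transfer (G □ H) 1 (u , a) (w , b) S S′ →
                      ∀ z → collapse α S′ z + 2 * α a * δ G u z ≡ collapse α S z + α b * δ G w z
  collapse-transfer α {S} {S′} {u} {w} {a} {b} T z = begin
    collapse α S′ z + 2 * α a * δ G u z
      ≡⟨ cong (collapse α S′ z +_) (trans (*-assoc 2 (α a) _) (cong (2 *_) (sym (collapse-δ α u z a)))) ⟩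
    collapse α S′ z + 2 * ∑ (vertices H) (λ m → α m * δ (G □ H) (u , a) (z , m))
      ≡⟨ cong (collapse α S′ z +_) (sym (∑-*ˡ 2 _ (vertices H))) ⟩
    collapse α S′ z + ∑ (vertices H) (λ m → 2 * (α m * δ (G □ H) (u , a) (z , m)))
      ≡⟨ sym (∑-+ _ _ (vertices H)) ⟩
    ∑ (vertices H) (λ m → α m * S′ (z , m) + 2 * (α m * δ (G □ H) (u , a) (z , m)))
      ≡⟨ ∑-cong (λ m → trans (sym (scale-source (α m) _ _)) (cong (α m *_) (balance T (z , m)))) (vertices H) ⟩
    ∑ (vertices H) (λ m → α m * (S (z , m) + 1 * δ (G □ H) (w , b) (z , m)))
      ≡⟨ ∑-cong (λ m → scale-target (α m) _ _) (vertices H) ⟩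
    ∑ (vertices H) (λ m → α m * S (z , m) + α m * δ (G □ H) (w , b) (z , m))
      ≡⟨ ∑-+ _ _ (vertices H) ⟩
    collapse α S z + ∑ (vertices H) (λ m → α m * δ (G □ H) (w , b) (z , m))
      ≡⟨ cong (collapse α S z +_) (collapse-δ α w z b) ⟩
    collapse α S z + α b * δ G w z ∎
    where
    open ≡-Reasoning
    scale-source : ∀ a x y → a * (x + 2 * 1 * y) ≡ a * x + 2 * (a * y)
    scale-source = solve-∀
    scale-target : ∀ a x y → a * (x + 1 * y) ≡ a * x + a * y
    scale-target = solve-∀

≤-rebalance : ∀ {x y d e r c c′} → x + d ≡ y + e → y ≤ r + c → c + e ≤ c′ + d → x ≤ r + c′
≤-rebalance {x} {y} {d} {e} {r} {c} {c′} x+d≡y+e y≤r+c slack = +-cancelʳ-≤ d x (r + c′) (begin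
  x + d        ≡⟨ x+d≡y+e ⟩
  y + e        ≤⟨ +-monoˡ-≤ e y≤r+c ⟩
  r + c + e    ≡⟨ +-assoc r c e ⟩
  r + (c + e)  ≤⟨ +-monoʳ-≤ r slack ⟩
  r + (c′ + d) ≡⟨ sym (+-assoc r c′ d) ⟩
  r + c′ + d   ∎)
  where open ≤-Reasoning

≤-relay : ∀ {x y d e r r′ c} → x + d ≡ y + e → y ≤ r + c → r′ + d ≡ r + e → x ≤ r′ + c
≤-relay {x} {y} {d} {e} {r} {r′} {c} x+d≡y+e y≤r+c r′+d≡r+e = +-cancelʳ-≤ d x (r′ + c) (begin
  x + d      ≡⟨ x+d≡y+e ⟩
  y + e      ≤⟨ +-monoˡ-≤ e y≤r+c ⟩
  r + c + e  ≡⟨ xy∙z≈xz∙y r c e ⟩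
  r + e + c  ≡⟨ cong (_+ c) (sym r′+d≡r+e) ⟩
  r′ + d + c ≡⟨ xy∙z≈xz∙y r′ d c ⟩
  r′ + c + d ∎)
  where open ≤-Reasoning

-- A credit at y allows R to fall short of the collapse by 2 at y, on account of the lone pebble
-- of layer k that R does not contain; it travels with that pebble while it stays at (y , k).
-- The condition j ≢ k in Backed disables credits in the empty-layer case, where k = j.
module Simulation (G H : Graph) (α : V H → ℕ) (1≤α : ∀ m → 1 ≤ α m) (α≤2 : ∀ m → α m ≤ 2)
                  (j k : V H) (αj≡2 : α j ≡ 2) (αk≡2 : α k ≡ 2) where

  bonus : Maybe (V G) → V G → ℕ
  bonus nothing  _ = 0
  bonus (just y) u = 2 * δ G y u

  Backed : Maybe (V G) → Distribution (G □ H) → Set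
  Backed nothing  _ = ⊤
  Backed (just y) S = j ≢ k × 1 ≤ S (y , k)

  Spends : Maybe (V G) → V (G □ H) → Set
  Spends nothing  _ = ⊥
  Spends (just y) p = p ≡ (y , k)

  spends? : ∀ cr p → Dec (Spends cr p)
  spends? nothing  _ = no λ ()
  spends? (just y) p = vertex-≟ (G □ H) p (y , k)

  record Covers (R : Distribution G) (S : Distribution (G □ H)) : Set where
    constructor covers
    field
      credit    : Maybe (V G)
      dominated : ∀ u → collapse G H α S u ≤ R u + bonus credit u
      backed    : Backed credit S

  weight-bound : ∀ {S} cr → Backed cr S → ∀ {u a} → ¬ Spends cr (u , a) →
                 α a * S (u , a) + bonus cr u ≤ collapse G H α S u
  weight-bound {S} nothing  _ {u} {a} _ =
    ≤-trans (≤-reflexive (+-identityʳ _)) (collapse-≥-point G H α S u a)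
  weight-bound {S} (just y) (_ , 1≤Syk) {u} {a} ¬sp with vertex-≟ G y u
  ... | yes refl = begin
    α a * S (y , a) + 2 * 1
      ≤⟨ +-monoʳ-≤ (α a * S (y , a)) (*-mono-≤ (≤-reflexive (sym αk≡2)) 1≤Syk) ⟩
    α a * S (y , a) + α k * S (y , k)
      ≤⟨ collapse-≥-pair G H α S y (¬sp ∘ cong (y ,_)) ⟩
    collapse G H α S y ∎
    where open ≤-Reasoning
  ... | no _ = ≤-trans (≤-reflexive (+-identityʳ _)) (collapse-≥-point G H α S u a)

  target-unspent : ∀ {S} cr → Backed cr S → ∀ v → ¬ Spends cr (v , j)
  target-unspent nothing  _         _ ()
  target-unspent (just y) (j≢k , _) _ = j≢k ∘ cong proj₂

  backed-stable : ∀ {S S′ p q} cr → ¬ Spends cr p → Transfer (G □ H) 1 p q S S′ →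
                  Backed cr S → Backed cr S′
  backed-stable nothing  _   _ _                = tt
  backed-stable (just y) ¬sp T (j≢k , 1≤Syk) = j≢k , ≤-trans 1≤Syk (transfer-≥ (G □ H) (¬sp ∘ sym) T)

  spend-credit : ∀ {R S S′ u a w b} cr → Spends cr (u , a) → Adj (G □ H) (u , a) (w , b) →
          Transfer (G □ H) 1 (u , a) (w , b) S S′ → (∀ z → collapse G H α S z ≤ R z + bonus cr z) →
          Backed cr S → Covers R S′
  spend-credit {R} {w = w} (just y) refl adj@(inj₁ (_ , refl)) T dom (j≢k , _) =
    covers (just w)
           (λ z → ≤-rebalance {r = R z} {c′ = bonus (just w) z} (collapse-transfer G H α T z) (dom z) (slack z))
           (j≢k , transfer-delivers (G □ H) (adj⇒≢ (G □ H) adj) T)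
    where
    2≤4 : 2 ≤ 4
    2≤4 = s≤s (s≤s z≤n)
    slack : ∀ z → 2 * δ G y z + α k * δ G w z ≤ 2 * δ G w z + 2 * α k * δ G y z
    slack z rewrite αk≡2 = ≤-trans (≤-reflexive (+-comm (2 * δ G y z) _))
                                   (+-monoʳ-≤ (2 * δ G w z) (*-monoˡ-≤ (δ G y z) 2≤4))
  spend-credit {R} {b = b} (just y) refl (inj₂ (refl , _)) T dom _ =
    covers nothing
           (λ z → ≤-rebalance {r = R z} {c′ = 0} (collapse-transfer G H α T z) (dom z) (slack z))
           tt
    where
    double : ∀ x → 2 * x + 2 * x ≡ 2 * 2 * x
    double = solve-∀
    slack : ∀ z → 2 * δ G y z + α b * δ G y z ≤ 2 * α k * δ G y z
    slack z rewrite αk≡2 = ≤-trans (+-monoʳ-≤ (2 * δ G y z) (*-monoˡ-≤ (δ G y z) (α≤2 b)))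
                                   (≤-reflexive (double (δ G y z)))

  keep-credit : ∀ {R S S′ u a w b} cr → ¬ Spends cr (u , a) → Adj (G □ H) (u , a) (w , b) → 2 ≤ S (u , a) →
         Transfer (G □ H) 1 (u , a) (w , b) S S′ → (∀ z → collapse G H α S z ≤ R z + bonus cr z) →
         Backed cr S → ∃ λ R′ → Reachable G R R′ × Covers R′ S′
  keep-credit {R} {S} {u = u} {a} cr ¬sp (inj₁ (adj , refl)) 2≤Sua T dom bk =
    let (R′ , moves , T′) = transfer G adj (α a) 2αa≤Ru
    in R′ , moves , covers cr
                              (λ z → ≤-relay {c = bonus cr z} (collapse-transfer G H α T z) (dom z) (balance T′ z))
                              (backed-stable cr ¬sp T bk)
    where
    2αa≤Ru : 2 * α a ≤ R u
    2αa≤Ru = +-cancelʳ-≤ (bonus cr u) _ _ (begin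
      2 * α a + bonus cr u         ≤⟨ +-monoˡ-≤ _ (≤-trans (≤-reflexive (*-comm 2 (α a)))
                                                           (*-monoʳ-≤ (α a) 2≤Sua)) ⟩
      α a * S (u , a) + bonus cr u ≤⟨ weight-bound cr bk ¬sp ⟩
      collapse G H α S u           ≤⟨ dom u ⟩
      R u + bonus cr u             ∎)
      where open ≤-Reasoning
  keep-credit {R} {u = u} {a} {b = b} cr ¬sp (inj₂ (refl , _)) _ T dom bk =
    R , ε , covers cr (λ z → ≤-rebalance {r = R z} {c′ = bonus cr z} (collapse-transfer G H α T z) (dom z)
                                         (+-monoʳ-≤ (bonus cr z) (*-monoˡ-≤ (δ G u z) αb≤2αa)))
                      (backed-stable cr ¬sp T bk)
    where
    αb≤2αa : α b ≤ 2 * α a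
    αb≤2αa = ≤-trans (α≤2 b) (*-monoʳ-≤ 2 (1≤α a))

  simulate-move : ∀ {R S S′} → Move (G □ H) S S′ → Covers R S →
                  ∃ λ R′ → Reachable G R R′ × Covers R′ S′
  simulate-move m (covers cr dom bk) with move⇒transfer (G □ H) m
  ... | (u , a) , _ , adj , 2≤Sua , T with spends? cr (u , a)
  ...   | yes sp  = _ , ε , spend-credit cr sp adj T dom bk
  ...   | no  ¬sp = keep-credit cr ¬sp adj 2≤Sua T dom bk

  simulate : ∀ {R S S′} → Reachable (G □ H) S S′ → Covers R S →
             ∃ λ R′ → Reachable G R R′ × Covers R′ S′
  simulate ε        cov = _ , ε , cov
  simulate (m ◅ ms) cov =
    let (R₁ , moves₁ , cov₁) = simulate-move m cov
        (R′ , moves′ , cov′) = simulate ms cov₁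
    in R′ , moves₁ ◅◅ moves′ , cov′

  harvest : ∀ {R S t v} → Covers R S → t ≤ S (v , j) → 2 * t ≤ R v
  harvest {R} {S} {t} {v} (covers cr dom bk) t≤Svj = +-cancelʳ-≤ (bonus cr v) (2 * t) (R v) (begin
    2 * t + bonus cr v           ≤⟨ +-monoˡ-≤ (bonus cr v) 2t≤αjSvj ⟩
    α j * S (v , j) + bonus cr v ≤⟨ weight-bound cr bk (target-unspent cr bk v) ⟩
    collapse G H α S v           ≤⟨ dom v ⟩
    R v + bonus cr v             ∎)
    where
    open ≤-Reasoning
    2t≤αjSvj : 2 * t ≤ α j * S (v , j)
    2t≤αjSvj = subst (λ x → 2 * t ≤ x * S (v , j)) (sym αj≡2) (*-monoʳ-≤ 2 t≤Svj)

  covers-solvable : ∀ {R S t} → Solvable (G □ H) t S → Covers R S → Solvable G (2 * t) R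
  covers-solvable solvable cov v =
    let (S′ , reach , t≤S′vj) = solvable (v , j)
        (R′ , moves , cov′) = simulate reach cov
    in R′ , moves , harvest cov′ t≤S′vj

module _ (G H : Graph) where

  empty-layer-collapse : ∀ {t S} (j : V H) → layer G H S j ≡ 0 → Solvable (G □ H) t S →
                         ∃ λ R → Solvable G (2 * t) R × size G R ≡ size (G □ H) S
  empty-layer-collapse {t} {S} j Lj≡0 solvable =
    collapse G H α S ,
    covers-solvable solvable (covers nothing (λ u → ≤-reflexive (sym (+-identityʳ _))) tt) ,
    size-eq
    where
    α : V H → ℕ
    α m = 1 + δ H j m

    αj≡2 : α j ≡ 2
    αj≡2 = cong suc (δ-refl H j)

    open Simulation G H α (λ _ → s≤s z≤n) (λ m → s≤s (δ≤1 H j m)) j j αj≡2 αj≡2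

    L : V H → ℕ
    L = layer G H S

    size-eq : size G (collapse G H α S) ≡ size (G □ H) S
    size-eq = begin
      size G (collapse G H α S)
        ≡⟨ size-collapse G H α S ⟩
      ∑ (vertices H) (λ m → L m + δ H j m * L m)
        ≡⟨ ∑-+ _ _ (vertices H) ⟩
      ∑ (vertices H) L + ∑ (vertices H) (λ m → δ H j m * L m)
        ≡⟨ cong (∑ (vertices H) L +_) (trans (∑-sift H j L) Lj≡0) ⟩
      ∑ (vertices H) L + 0
        ≡⟨ +-identityʳ _ ⟩
      ∑ (vertices H) L
        ≡⟨ sym (size-□-layers G H S) ⟩
      size (G □ H) S ∎
      where open ≡-Reasoning

  singleton-layers-collapse : ∀ {t S} {j k : V H} → j ≢ k → layer G H S j ≡ 1 → layer G H S k ≡ 1 →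
                              Solvable (G □ H) t S →
                              ∃ λ R → Solvable G (2 * t) R × size G R ≡ size (G □ H) S
  singleton-layers-collapse {t} {S} {j} {k} j≢k Lj≡1 Lk≡1 solvable =
    collapse G H β S , covers-solvable solvable (covers (just x) dominated (j≢k , 1≤Sxk)) , size-eq
    where
    α β : V H → ℕ
    α m = 1 + δ H j m + δ H k m
    β m = 1 + δ H j m ∸ δ H k m

    open Simulation G H α (λ _ → s≤s z≤n) (λ m → s≤s (δ-disjoint H j≢k m)) j k
                    (cong₂ (λ p q → 1 + p + q) (δ-refl H j) (δ-≢ H (j≢k ∘ sym)))
                    (cong₂ (λ p q → 1 + p + q) (δ-≢ H j≢k) (δ-refl H k))

    β+δk : ∀ m → β m + δ H k m ≡ 1 + δ H j m
    β+δk m = m∸n+n≡m (≤-trans (δ≤1 H k m) (s≤s z≤n))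

    α≡β+2δk : ∀ m → α m ≡ β m + 2 * δ H k m
    α≡β+2δk m = trans (cong (_+ δ H k m) (sym (β+δk m))) (twice (β m) (δ H k m))
      where
      twice : ∀ b d → b + d + d ≡ b + 2 * d
      twice = solve-∀

    lone : ∃ λ x → ∀ u → S (u , k) ≡ δ G x u
    lone = ∑≡1⇒δ G (λ u → S (u , k)) Lk≡1

    x : V G
    x = proj₁ lone

    dominated : ∀ u → collapse G H α S u ≤ collapse G H β S u + bonus (just x) u
    dominated u = ≤-reflexive (trans (collapse-split G H α β 2 k α≡β+2δk S u)
                                     (cong (λ n → collapse G H β S u + 2 * n) (proj₂ lone u)))

    1≤Sxk : 1 ≤ S (x , k)
    1≤Sxk = ≤-reflexive (sym (trans (proj₂ lone x) (δ-refl G x)))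

    L : V H → ℕ
    L = layer G H S

    size-eq : size G (collapse G H β S) ≡ size (G □ H) S
    size-eq = +-cancelʳ-≡ 1 _ _ (begin
      size G (collapse G H β S) + 1
        ≡⟨ cong₂ _+_ (size-collapse G H β S) (sym (trans (∑-sift H k L) Lk≡1)) ⟩
      ∑ (vertices H) (λ m → β m * L m) + ∑ (vertices H) (λ m → δ H k m * L m)
        ≡⟨ sym (∑-+ _ _ (vertices H)) ⟩
      ∑ (vertices H) (λ m → β m * L m + δ H k m * L m)
        ≡⟨ ∑-cong (λ m → trans (sym (*-distribʳ-+ (L m) (β m) _)) (cong (_* L m) (β+δk m))) (vertices H) ⟩
      ∑ (vertices H) (λ m → L m + δ H j m * L m)
        ≡⟨ ∑-+ _ _ (vertices H) ⟩
      ∑ (vertices H) L + ∑ (vertices H) (λ m → δ H j m * L m)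
        ≡⟨ cong₂ _+_ (sym (size-□-layers G H S)) (trans (∑-sift H j L) Lj≡1) ⟩
      size (G □ H) S + 1 ∎)
      where open ≡-Reasoning

  collapse-solvable : ∀ {t S} → 2 + size (G □ H) S ≤ 2 * length (vertices H) → Solvable (G □ H) t S →
                      ∃ λ R → Solvable G (2 * t) R × size G R ≡ size (G □ H) S
  collapse-solvable {S = S} small solvable
    with empty-or-two-singletons (layer G H S) (unique H) (subst (λ s → 2 + s ≤ _) (size-□-layers G H S) small)
  ... | inj₁ (j , _ , Lj≡0)                     = empty-layer-collapse j Lj≡0 solvable
  ... | inj₂ (j , k , _ , _ , j≢k , Lj≡1 , Lk≡1) = singleton-layers-collapse j≢k Lj≡1 Lk≡1 solvable

module _ (G H : Graph) (x₀ : V H) where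

  lift : Distribution G → Distribution (G □ H)
  lift D (u , m) = δ H x₀ m * D u

  lift-base : ∀ D u → lift D (u , x₀) ≡ D u
  lift-base D u = trans (cong (_* D u) (δ-refl H x₀)) (*-identityˡ (D u))

  lift-transfer : ∀ {c u w D D′} → Transfer G c u w D D′ →
                  Transfer (G □ H) c (u , x₀) (w , x₀) (lift D) (lift D′)
  lift-transfer {c} {u} {w} {D} {D′} T = transferred lifted
    where
    open ≡-Reasoning
    factor : ∀ x d c y → x * d + c * (y * x) ≡ x * (d + c * y)
    factor = solve-∀
    lifted : ∀ p → lift D′ p + 2 * c * δ (G □ H) (u , x₀) p ≡ lift D p + c * δ (G □ H) (w , x₀) p
    lifted (z , m) = begin
      δ H x₀ m * D′ z + 2 * c * δ (G □ H) (u , x₀) (z , m)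
        ≡⟨ cong (λ d → δ H x₀ m * D′ z + 2 * c * d) (δ-pair G H u z x₀ m) ⟩
      δ H x₀ m * D′ z + 2 * c * (δ G u z * δ H x₀ m)
        ≡⟨ factor (δ H x₀ m) (D′ z) (2 * c) (δ G u z) ⟩
      δ H x₀ m * (D′ z + 2 * c * δ G u z)
        ≡⟨ cong (δ H x₀ m *_) (balance T z) ⟩
      δ H x₀ m * (D z + c * δ G w z)
        ≡⟨ sym (factor (δ H x₀ m) (D z) c (δ G w z)) ⟩
      δ H x₀ m * D z + c * (δ G w z * δ H x₀ m)
        ≡⟨ cong (λ d → δ H x₀ m * D z + c * d) (sym (δ-pair G H w z x₀ m)) ⟩
      δ H x₀ m * D z + c * δ (G □ H) (w , x₀) (z , m) ∎

  lift-move : ∀ {D D′} → Move G D D′ → Move (G □ H) (lift D) (lift D′)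
  lift-move {D} m with move⇒transfer G m
  ... | u , w , adj , 2≤Du , T =
    transfer⇒move (G □ H) (inj₁ (adj , refl)) (subst (2 ≤_) (sym (lift-base D u)) 2≤Du) (lift-transfer T)

  lift-reachable : ∀ {D D′} → Reachable G D D′ → Reachable (G □ H) (lift D) (lift D′)
  lift-reachable = gmap lift lift-move

  size-lift : ∀ D → size (G □ H) (lift D) ≡ size G D
  size-lift D = trans (size-□ G H (lift D)) (∑-cong (λ u → ∑-sift H x₀ (λ _ → D u)) (vertices G))

  lift-solvable : ∀ {t D} → (∀ m → x₀ ≢ m → Adj H x₀ m) →
                  Solvable G (2 * t) D → Solvable (G □ H) t (lift D)
  lift-solvable {t} {D} universal solvable (v , m) with solvable v
  ... | D′ , moves , 2t≤D′v = reach (vertex-≟ H x₀ m)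
    where
    2t≤lift : 2 * t ≤ lift D′ (v , x₀)
    2t≤lift = subst (2 * t ≤_) (sym (lift-base D′ v)) 2t≤D′v

    reach : Dec (x₀ ≡ m) → ∃ λ S → Reachable (G □ H) (lift D) S × t ≤ S (v , m)
    reach (yes refl) = lift D′ , lift-reachable moves , ≤-trans (m≤m+n t (t + 0)) 2t≤lift
    reach (no x₀≢m)  =
      let (D″ , shipped , T) = transfer (G □ H) adj t 2t≤lift
      in D″ , lift-reachable moves ◅◅ shipped , transfer-delivers (G □ H) (adj⇒≢ (G □ H) adj) T
      where
      adj : Adj (G □ H) (v , x₀) (v , m)
      adj = inj₂ (refl , universal m x₀≢m)

theorem3p8 : (G : Graph) (n t : ℕ) → 1 ≤ n → 1 ≤ t →
    (a b : ℕ) → IsOptPebbling (G □ K n) t a → IsOptPebbling G (2 * t) b →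
    a ≤ b × (2 * n ≥ b + 1 → a ≡ b)
theorem3p8 G zero    t ()
theorem3p8 G n@(suc _) t _ _ a b ((D , D-solvable , size-D) , a-minimal) ((E , E-solvable , size-E) , b-minimal) =
  a≤b , a≡b
  where
  a≤b : a ≤ b
  a≤b = begin
    a                                     ≤⟨ a-minimal _ (lift-solvable G (K n) fzero (λ _ → id) E-solvable) ⟩
    size (G □ K n) (lift G (K n) fzero E) ≡⟨ size-lift G (K n) fzero E ⟩
    size G E                              ≡⟨ size-E ⟩
    b                                     ∎
    where open ≤-Reasoning

  a≡b : 2 * n ≥ b + 1 → a ≡ b
  a≡b 2n≥b+1 = ≤-antisym a≤b (≮⇒≥ λ a<b → <⇒≱ a<b (b≤a a<b))
    where
    b≤a : a < b → b ≤ a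
    b≤a a<b =
      let (R , R-solvable , size-R) = collapse-solvable G (K n) small D-solvable
      in subst (b ≤_) (trans size-R size-D) (b-minimal R R-solvable)
      where
      open ≤-Reasoning
      small : 2 + size (G □ K n) D ≤ 2 * length (vertices (K n))
      small = begin
        2 + size (G □ K n) D        ≡⟨ cong (2 +_) size-D ⟩
        2 + a                       ≤⟨ s≤s a<b ⟩
        1 + b                       ≡⟨ +-comm 1 b ⟩
        b + 1                       ≤⟨ 2n≥b+1 ⟩
        2 * n                       ≡⟨ cong (2 *_) (sym (length-tabulate {n = n} id)) ⟩
        2 * length (vertices (K n)) ∎
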